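{- Let $k\ge 0$ and $n\ge 1$ be integers, and let $\alpha\in\mathbb{Z}$ satisfy $\alpha^n\equiv 1\pmod n$. Then \[ \sum_{i=0}^{n-1} i^{\underline{k}}\,\alpha^{i-k}\equiv 0\pmod n \] if and only if at least one of the following holds: (a) $k+1$ is neither equal to $4$ nor equal to a prime; (b) $k+1=4$ and $4\nmid n$; (c) $k+1$ is a prime $q$, and either $q\nmid n$ or $\alpha\not\equiv 1\pmod q$.
   Context: For integers $m$ and $k\ge 0$, the falling factorial is $m^{\underline{k}}=m(m-1)\cdots(m-k+1)$ for $k>0$ and $m^{\underline{0}}=1$; note $m^{\underline{k}}=0$ when $0\le m<k$. In the sum, the terms with $i<k$ are zero (since $i^{\underline{k}}=0$), so only nonnegative powers of $\alpha$ actually occur. The sum equals $f^{(k)}(\alpha)$, the $k$th derivative of $f(t)=\sum_{i=0}^{n-1}t^i$ evaluated at $\alpha$. -}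

module Defs where

open import Data.Nat using (ℕ; zero; suc; _∸_)
import Data.Nat as ℕ
open import Data.Integer using (ℤ; +_; _+_; _*_; _^_)

fall : ℕ → ℕ → ℕ
fall m zero    = 1
fall m (suc k) = fall m k ℕ.* (m ∸ k)

sumTo : ℕ → (ℕ → ℤ) → ℤ
sumTo zero    f = + 0
sumTo (suc n) f = sumTo n f + f n

-- S(n,k,α) = Σ_{i=0}^{n-1} i^{\underline k} α^{i-k}.
-- For i < k the falling factorial is 0, so using truncated i ∸ k is harmless.
S : ℕ → ℕ → ℤ → ℤ
S n k α = sumTo n (λ i → + fall i k * α ^ (i ∸ k))

{-# OPTIONS --safe #-}
-- Write β = α - 1.  Divisibility by n can be checked one prime power p ^ e ∣ n at a time.
--
-- If p ∤ β: differentiating (t - 1) * Σ_{i<n} t ^ i = t ^ n - 1 gives β * S n 0 α = α ^ n - 1 and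
-- β * S n (k + 1) α + (k + 1) * S n k α = n^{\underline{k+1}} * α ^ (n - k - 1), so p ^ e ∣ S n k α
-- follows by induction on k from p ^ e ∣ α ^ n - 1.
--
-- If p ∣ β: expanding at 1, S n k α = Σ_j C(n, k + j + 1) * (k + j)^{\underline k} * β ^ j, and p ^ e
-- divides every term with j ≥ 1; so p ^ e ∣ S n k α iff p ^ e divides the leading coefficient
-- L = C(n, k + 1) * k!, where (k + 1) * L = n * (n - 1)^{\underline k}.  Now n ∣ L when (k + 1) ∣ k!
-- (k + 1 composite and ≠ 4) or when k + 1 = 4 ∤ n, and p ^ e ∣ L when k + 1 is a prime other than p.
-- In the two remaining cases, a prime q = k + 1 dividing n and β, or k + 1 = 4 ∣ n (where α ^ n ≡ 1
-- forces 2 ∣ β), the q-part resp. 2-part of n does not divide L.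
module Submission where

open import Defs
open import Data.Product using (_×_; _,_; ∃-syntax; ∃₂)
open import Data.Sum using (_⊎_; inj₁; inj₂; [_,_]′)
open import Function using (_∘_)
open import Relation.Nullary using (¬_; yes; no; contradiction)
open import Relation.Binary.PropositionalEquality

module NatArithmetic where
  open import Data.Nat
  open import Data.Nat.Properties
  open import Data.Nat.Divisibility
  open import Data.Nat.Primality using (Prime; euclidsLemma; prime⇒nonZero; prime⇒nonTrivial; prime[2])
  open import Data.Nat.Primality.Factorisation using (factorise)
  open import Data.Nat.ListAction using (product)
  open import Data.Nat.Induction using (<-wellFounded)
  open import Data.Nat.Tactic.RingSolver using (solve-∀)
  open import Data.List.Base using (_∷_)
  open import Data.List.Relation.Unary.All using (_∷_)
  open import Induction.WellFounded using (Acc; acc)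

  prime⇒1<p : ∀ {p} → Prime p → 1 < p
  prime⇒1<p {p} pr = nonTrivial⇒n>1 p {{prime⇒nonTrivial pr}}

  p^e∣m*n⇒p^e∣n : ∀ {p m n} e → Prime p → ¬ p ∣ m → p ^ e ∣ m * n → p ^ e ∣ n
  p^e∣m*n⇒p^e∣n {n = n} zero _ _ _ = 1∣ n
  p^e∣m*n⇒p^e∣n {p} {m} (suc e) pr p∤m p^[1+e]∣mn
    with euclidsLemma m _ pr (∣-trans (m∣m*n (p ^ e)) p^[1+e]∣mn)
  ... | inj₁ p∣m = contradiction p∣m p∤m
  ... | inj₂ (divides q refl) = subst (p ^ suc e ∣_) (*-comm p q) (*-monoʳ-∣ p p^e∣q)
    where
    instance _ = prime⇒nonZero pr
    regroup : ∀ m q p → m * (q * p) ≡ p * (m * q)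
    regroup = solve-∀
    p^e∣q : p ^ e ∣ q
    p^e∣q = p^e∣m*n⇒p^e∣n e pr p∤m
      (*-cancelˡ-∣ p (subst (p ^ suc e ∣_) (regroup m q p) p^[1+e]∣mn))

  factor-out : ∀ {p} → 1 < p → ∀ n .{{_ : NonZero n}} → ∃₂ λ s r → n ≡ p ^ s * r × ¬ p ∣ r
  factor-out {p} 1<p n = go n (<-wellFounded n)
    where
    regroup : ∀ a r p → a * r * p ≡ p * a * r
    regroup = solve-∀
    go : ∀ n .{{_ : NonZero n}} → Acc _<_ n → ∃₂ λ s r → n ≡ p ^ s * r × ¬ p ∣ r
    go n (acc rec) with p ∣? n
    ... | no p∤n = 0 , n , sym (*-identityˡ n) , p∤n
    ... | yes (divides q refl) with go q {{q≢0}} (rec (m<m*n q p {{q≢0}} 1<p))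
      where q≢0 = m*n≢0⇒m≢0 q
    ...   | s , r , refl , p∤r = suc s , r , regroup (p ^ s) r p , p∤r

  ∃-prime-divisor : ∀ n → 1 < n → ∃[ p ] Prime p × p ∣ n
  ∃-prime-divisor 1 (s≤s ())
  ∃-prime-divisor n@(suc (suc _)) _ with factorise n
  ... | record { factors = p ∷ ps ; isFactorisation = n≡p*ps ; factorsPrime = pr ∷ _ } =
    p , pr , divides (product ps) (trans n≡p*ps (*-comm p (product ps)))

  p^e∣x∧m∣x⇒p^e*m∣x : ∀ {p e m x} → Prime p → ¬ p ∣ m → p ^ e ∣ x → m ∣ x → p ^ e * m ∣ x
  p^e∣x∧m∣x⇒p^e*m∣x {p} {e} {m} pr p∤m p^e∣x (divides c refl) =
    *-monoˡ-∣ m (p^e∣m*n⇒p^e∣n e pr p∤m (subst (p ^ e ∣_) (*-comm c m) p^e∣x))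

  ∣-by-prime-powers : ∀ n .{{_ : NonZero n}} x →
                      (∀ {p e} → Prime p → p ^ e ∣ n → p ^ e ∣ x) → n ∣ x
  ∣-by-prime-powers n x = go n (<-wellFounded n)
    where
    go : ∀ n .{{_ : NonZero n}} → Acc _<_ n → (∀ {p e} → Prime p → p ^ e ∣ n → p ^ e ∣ x) → n ∣ x
    go 1 _ _ = 1∣ x
    go n@(suc (suc _)) (acc rec) local with ∃-prime-divisor n (s≤s (s≤s z≤n))
    ... | p , pr , p∣n with factor-out (prime⇒1<p pr) n
    ...   | zero , r , n≡r , p∤r = contradiction (subst (p ∣_) (trans n≡r (*-identityˡ r)) p∣n) p∤r
    ...   | suc s , r , n≡p^s*r , p∤r =
      subst (_∣ x) (sym n≡p^s*r)
        (p^e∣x∧m∣x⇒p^e*m∣x {e = suc s} pr p∤r (local {e = suc s} pr p^s∣n)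
                                              (go r {{r≢0}} (rec r<n) (λ {q} {e} → local-r {q} {e})))
      where
      r≢0 = m*n≢0⇒n≢0 (p ^ suc s) {{subst NonZero n≡p^s*r _}}
      p^s∣n : p ^ suc s ∣ n
      p^s∣n = subst (p ^ suc s ∣_) (sym n≡p^s*r) (m∣m*n r)
      r∣n : r ∣ n
      r∣n = subst (r ∣_) (sym n≡p^s*r) (n∣m*n (p ^ suc s))
      r<n : r < n
      r<n = subst (r <_) (trans (*-comm r (p ^ suc s)) (sym n≡p^s*r))
              (m<m*n r (p ^ suc s) {{r≢0}} (^-monoʳ-< p (prime⇒1<p pr) {0} {suc s} z<s))
      local-r : ∀ {q e} → Prime q → q ^ e ∣ r → q ^ e ∣ x
      local-r {q} {e} pr′ q^e∣r = local {q} {e} pr′ (∣-trans q^e∣r r∣n)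

  c*t≡a*x∧a∣t⇒c∣x : ∀ {a c t x} .{{_ : NonZero a}} → c * t ≡ a * x → a ∣ t → c ∣ x
  c*t≡a*x∧a∣t⇒c∣x {a} {c} {x = x} c*t≡a*x (divides q refl) =
    divides q (*-cancelˡ-≡ x (q * c) a (trans (sym c*t≡a*x) (regroup c q a)))
    where
    regroup : ∀ c q a → c * (q * a) ≡ a * (q * c)
    regroup = solve-∀

  ^-monoˡ-∣ : ∀ {m n} j → m ∣ n → m ^ j ∣ n ^ j
  ^-monoˡ-∣ zero    _   = ∣-refl
  ^-monoˡ-∣ (suc j) m∣n = *-pres-∣ m∣n (^-monoˡ-∣ j m∣n)

  ¬2∣1+2*x : ∀ x → ¬ 2 ∣ 1 + 2 * x
  ¬2∣1+2*x x 2∣1+2x =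
    contradiction (∣1⇒≡1 (∣m+n∣m⇒∣n (subst (2 ∣_) (+-comm 1 (2 * x)) 2∣1+2x) (m∣m*n x))) λ ()

  ¬2∣m*n : ∀ {m n} → ¬ 2 ∣ m → ¬ 2 ∣ n → ¬ 2 ∣ m * n
  ¬2∣m*n 2∤m 2∤n 2∣mn = [ 2∤m , 2∤n ]′ (euclidsLemma _ _ prime[2] 2∣mn)

  n<p^n : ∀ {p} n → 1 < p → n < p ^ n
  n<p^n zero _ = z<s
  n<p^n {p} (suc n) 1<p = ≤-<-trans (n<p^n n 1<p) (subst (_< p * p ^ n) (*-identityˡ (p ^ n)) (*-monoˡ-< (p ^ n) 1<p))
    where instance _ = m^n≢0 p n {{>-nonZero (<-trans z<s 1<p)}}

  m+n≤m*n : ∀ {m n} → 1 < m → 1 < n → m + n ≤ m * n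
  m+n≤m*n {suc (suc x)} {suc (suc y)} (s≤s (s≤s _)) (s≤s (s≤s _)) =
    subst (2 + x + (2 + y) ≤_) (sym (expand x y)) (m≤m+n _ (x * y + x + y))
    where
    expand : ∀ x y → (2 + x) * (2 + y) ≡ 2 + x + (2 + y) + (x * y + x + y)
    expand = solve-∀

module FallingFactorial where
  open import Data.Nat
  open import Data.Nat.Properties
  open import Data.Nat.Divisibility
  open import Data.Nat.Combinatorics using (_C_; nCn≡1; nCk+nC[k+1]≡[n+1]C[k+1])
  open import Data.Nat.DivMod using (m≡m%n+[m/n]*n; m%n<n)
  open import Data.Nat.Primality using (Prime; euclidsLemma; ¬prime⇒composite; ¬prime[1])
  open import Data.Nat.Tactic.RingSolver using (solve-∀)
  open import Relation.Binary.Definitions using (Tri; tri<; tri≈; tri>)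
  open import Algebra.Properties.CommutativeSemigroup *-commutativeSemigroup using (x∙yz≈y∙xz)
  open NatArithmetic

  m<k⇒fall≡0 : ∀ {m k} → m < k → fall m k ≡ 0
  m<k⇒fall≡0 {m} {suc k} (s≤s m≤k) = trans (cong (fall m k *_) (m≤n⇒m∸n≡0 m≤k)) (*-zeroʳ (fall m k))

  fall-suc : ∀ m k → fall m (suc k) ≡ m * fall (m ∸ 1) k
  fall-suc m zero = *-comm 1 m
  fall-suc m (suc k) = begin
    fall m (suc k) * (m ∸ suc k)           ≡⟨ cong₂ _*_ (fall-suc m k) (sym (∸-+-assoc m 1 k)) ⟩
    m * fall (m ∸ 1) k * (m ∸ 1 ∸ k)       ≡⟨ *-assoc m _ _ ⟩
    m * (fall (m ∸ 1) k * (m ∸ 1 ∸ k))     ∎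
    where open ≡-Reasoning

  fall-pascal : ∀ m k → fall (suc m) (suc k) ≡ fall m (suc k) + suc k * fall m k
  fall-pascal m k with k ≤? m
  ... | yes k≤m = begin
    fall (suc m) (suc k)                    ≡⟨ fall-suc (suc m) k ⟩
    suc m * fall m k                        ≡⟨ cong (_* fall m k) (sym (trans (+-suc (m ∸ k) k) (cong suc (m∸n+n≡m k≤m)))) ⟩
    (m ∸ k + suc k) * fall m k              ≡⟨ *-distribʳ-+ (fall m k) (m ∸ k) (suc k) ⟩
    (m ∸ k) * fall m k + suc k * fall m k   ≡⟨ cong (_+ suc k * fall m k) (*-comm (m ∸ k) (fall m k)) ⟩
    fall m k * (m ∸ k) + suc k * fall m k   ∎
    where open ≡-Reasoning
  ... | no k≰m = begin
    fall (suc m) (suc k)                    ≡⟨ fall-suc (suc m) k ⟩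
    suc m * fall m k                        ≡⟨ cong (suc m *_) fall≡0 ⟩
    suc m * 0                               ≡⟨ *-zeroʳ (suc m) ⟩
    0                                       ≡⟨ sym (*-zeroʳ (suc k)) ⟩
    suc k * 0                               ≡⟨ cong₂ (λ a b → a + suc k * b) (sym (m<k⇒fall≡0 (m<n⇒m<1+n (≰⇒> k≰m)))) (sym fall≡0) ⟩
    fall m (suc k) + suc k * fall m k       ∎
    where
    open ≡-Reasoning
    fall≡0 : fall m k ≡ 0
    fall≡0 = m<k⇒fall≡0 (≰⇒> k≰m)

  m∸i∣fall : ∀ m {i k} → i < k → m ∸ i ∣ fall m k
  m∸i∣fall m {i} {suc k} i<1+k with m<1+n⇒m<n∨m≡n i<1+k
  ... | inj₁ i<k  = ∣m⇒∣m*n (m ∸ k) (m∸i∣fall m i<k)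
  ... | inj₂ refl = n∣m*n (fall m k)

  ∣suc⇒∣fall : ∀ {d m k} → 0 < d → d ≤ k → d ∣ suc m → d ∣ fall m k
  ∣suc⇒∣fall {suc d} {m} _ 1+d≤k (divides c 1+m≡c*[1+d]) =
    ∣-trans (divides (c ∸ 1) m∸d≡[c∸1]*[1+d]) (m∸i∣fall m 1+d≤k)
    where
    m∸d≡[c∸1]*[1+d] : m ∸ d ≡ (c ∸ 1) * suc d
    m∸d≡[c∸1]*[1+d] = trans (cong₂ _∸_ 1+m≡c*[1+d] (sym (*-identityˡ (suc d))))
                            (sym (*-distribʳ-∸ (suc d) c 1))

  C*!≡fall : ∀ n k → (n C k) * k ! ≡ fall n k
  C*!≡fall n zero = refl
  C*!≡fall zero (suc k) = sym (m<k⇒fall≡0 {0} {suc k} z<s)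
  C*!≡fall (suc n) (suc k) = begin
    (suc n C suc k) * suc k !                   ≡⟨ cong (_* suc k !) (sym (nCk+nC[k+1]≡[n+1]C[k+1] n k)) ⟩
    ((n C k) + (n C suc k)) * suc k !           ≡⟨ *-distribʳ-+ (suc k !) (n C k) (n C suc k) ⟩
    (n C k) * (suc k * k !) + (n C suc k) * suc k !  ≡⟨ cong₂ _+_ (x∙yz≈y∙xz (n C k) (suc k) (k !)) (C*!≡fall n (suc k)) ⟩
    suc k * ((n C k) * k !) + fall n (suc k)    ≡⟨ cong (λ x → suc k * x + fall n (suc k)) (C*!≡fall n k) ⟩
    suc k * fall n k + fall n (suc k)           ≡⟨ +-comm (suc k * fall n k) (fall n (suc k)) ⟩
    fall n (suc k) + suc k * fall n k           ≡⟨ sym (fall-pascal n k) ⟩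
    fall (suc n) (suc k)                        ∎
    where open ≡-Reasoning

  fall[n,n]≡n! : ∀ n → fall n n ≡ n !
  fall[n,n]≡n! n = trans (sym (C*!≡fall n n)) (trans (cong (_* n !) (nCn≡1 n)) (*-identityˡ (n !)))

  fall-+ : ∀ n k j → fall n (k + j) ≡ fall n k * fall (n ∸ k) j
  fall-+ n k zero = trans (cong (fall n) (+-identityʳ k)) (sym (*-identityʳ (fall n k)))
  fall-+ n k (suc j) = begin
    fall n (k + suc j)                                ≡⟨ cong (fall n) (+-suc k j) ⟩
    fall n (k + j) * (n ∸ (k + j))                    ≡⟨ cong₂ _*_ (fall-+ n k j) (sym (∸-+-assoc n k j)) ⟩
    fall n k * fall (n ∸ k) j * (n ∸ k ∸ j)           ≡⟨ *-assoc (fall n k) _ _ ⟩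
    fall n k * (fall (n ∸ k) j * (n ∸ k ∸ j))         ∎
    where open ≡-Reasoning

  C-fall : ∀ n k j → (n C (k + j)) * fall (k + j) k ≡ fall n k * ((n ∸ k) C j)
  C-fall n k j = *-cancelʳ-≡ _ _ (j !) {{j !≢0}} (begin
    (n C (k + j)) * fall (k + j) k * j !          ≡⟨ *-assoc (n C (k + j)) _ _ ⟩
    (n C (k + j)) * (fall (k + j) k * j !)        ≡⟨ cong ((n C (k + j)) *_) fall*j!≡[k+j]! ⟩
    (n C (k + j)) * (k + j) !                     ≡⟨ C*!≡fall n (k + j) ⟩
    fall n (k + j)                                ≡⟨ fall-+ n k j ⟩
    fall n k * fall (n ∸ k) j                     ≡⟨ cong (fall n k *_) (sym (C*!≡fall (n ∸ k) j)) ⟩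
    fall n k * (((n ∸ k) C j) * j !)              ≡⟨ sym (*-assoc (fall n k) _ _) ⟩
    fall n k * ((n ∸ k) C j) * j !                ∎)
    where
    open ≡-Reasoning
    fall*j!≡[k+j]! : fall (k + j) k * j ! ≡ (k + j) !
    fall*j!≡[k+j]! = begin
      fall (k + j) k * j !                        ≡⟨ cong (fall (k + j) k *_) (sym (fall[n,n]≡n! j)) ⟩
      fall (k + j) k * fall j j                   ≡⟨ cong (λ i → fall (k + j) k * fall i j) (sym (m+n∸m≡n k j)) ⟩
      fall (k + j) k * fall (k + j ∸ k) j         ≡⟨ sym (fall-+ (k + j) k j) ⟩
      fall (k + j) (k + j)                        ≡⟨ fall[n,n]≡n! (k + j) ⟩
      (k + j) !                                   ∎

  k!∣fall : ∀ m k → k ! ∣ fall m k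
  k!∣fall m k = divides (m C k) (sym (C*!≡fall m k))

  n∣[1+j]*nC[1+j] : ∀ n j → n ∣ suc j * (n C suc j)
  n∣[1+j]*nC[1+j] n j = divides ((n ∸ 1) C j) (begin
    suc j * (n C suc j)           ≡⟨ cong (_* (n C suc j)) (sym (*-identityˡ (suc j))) ⟩
    fall (suc j) 1 * (n C suc j)  ≡⟨ *-comm (fall (suc j) 1) (n C suc j) ⟩
    (n C suc j) * fall (suc j) 1  ≡⟨ C-fall n 1 j ⟩
    fall n 1 * ((n ∸ 1) C j)      ≡⟨ cong (_* ((n ∸ 1) C j)) (*-identityˡ n) ⟩
    n * ((n ∸ 1) C j)             ≡⟨ *-comm n ((n ∸ 1) C j) ⟩
    ((n ∸ 1) C j) * n             ∎)
    where open ≡-Reasoning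

  leadingCoeff : ℕ → ℕ → ℕ
  leadingCoeff n k = (n C suc k) * k !

  [1+k]*leadingCoeff≡n*fall : ∀ n k → suc k * leadingCoeff n k ≡ n * fall (n ∸ 1) k
  [1+k]*leadingCoeff≡n*fall n k = begin
    suc k * ((n C suc k) * k !)   ≡⟨ x∙yz≈y∙xz (suc k) (n C suc k) (k !) ⟩
    (n C suc k) * suc k !         ≡⟨ C*!≡fall n (suc k) ⟩
    fall n (suc k)                ≡⟨ fall-suc n k ⟩
    n * fall (n ∸ 1) k            ∎
    where open ≡-Reasoning

  n∣leadingCoeff : ∀ {n k} → suc k ∣ fall (n ∸ 1) k → n ∣ leadingCoeff n k
  n∣leadingCoeff {n} {k} = c*t≡a*x∧a∣t⇒c∣x (sym ([1+k]*leadingCoeff≡n*fall n k))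

  n∣n! : ∀ {n} → 0 < n → n ∣ n !
  n∣n! {suc n} _ = m∣m*n (n !)

  d*e∣k! : ∀ {d e k} → 0 < d → d < e → e ≤ k → d * e ∣ k !
  d*e∣k! {d} {suc e} 0<d (s≤s d≤e) 1+e≤k = ∣-trans d*[1+e]∣[1+e]! (m≤n⇒m!∣n! 1+e≤k)
    where
    d*[1+e]∣[1+e]! : d * suc e ∣ suc e !
    d*[1+e]∣[1+e]! = subst (d * suc e ∣_) (*-comm (e !) (suc e))
                       (*-pres-∣ (∣-trans (n∣n! 0<d) (m≤n⇒m!∣n! d≤e)) ∣-refl)

  ¬prime⇒product : ∀ {n} → 1 < n → ¬ Prime n → ∃₂ λ d e → 1 < d × 1 < e × n ≡ d * e
  ¬prime⇒product {n} 1<n ¬prime with ¬prime⇒composite {{n>1⇒nonTrivial 1<n}} ¬prime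
  ... | hasNonTrivialDivisor {d} d<n d∣n =
    d , quotient d∣n , nonTrivial⇒n>1 d , quotient>1 d∣n d<n , m∣n⇒n≡m*quotient d∣n

  [1+k]∣k! : ∀ {k} → ¬ Prime (suc k) → suc k ≢ 4 → suc k ∣ k !
  [1+k]∣k! {zero} _ _ = ∣-refl
  [1+k]∣k! {suc k} ¬prime ≢4 with ¬prime⇒product (s≤s (s≤s z≤n)) ¬prime
  ... | d , e , 1<d , 1<e , n≡d*e = subst (_∣ suc k !) (sym n≡d*e) (cases (<-cmp d e))
    where
    instance
      _ = >-nonZero (<-trans z<s 1<d)
      _ = >-nonZero (<-trans z<s 1<e)
    d<n : d < suc (suc k)
    d<n = subst (d <_) (sym n≡d*e) (m<m*n d e 1<e)
    e<n : e < suc (suc k)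
    e<n = subst (e <_) (trans (*-comm e d) (sym n≡d*e)) (m<m*n e d 1<d)
    cases : Tri (d < e) (d ≡ e) (e < d) → d * e ∣ suc k !
    cases (tri< d<e _ _) = d*e∣k! (<-trans z<s 1<d) d<e (≤-pred e<n)
    cases (tri> _ _ e<d) = subst (_∣ suc k !) (*-comm e d) (d*e∣k! (<-trans z<s 1<e) e<d (≤-pred d<n))
    cases (tri≈ _ refl _) = ∣-trans (*-monoʳ-∣ d (n∣m*n 2)) (d*e∣k! (<-trans z<s 1<d) d<2*d (≤-pred 2*d<n))
      where
      2<d : 2 < d
      2<d = ≤∧≢⇒< 1<d (λ 2≡d → ≢4 (trans n≡d*e (cong (λ x → x * x) (sym 2≡d))))
      d<2*d : d < 2 * d
      d<2*d = subst (_< 2 * d) (*-identityˡ d) (*-monoˡ-< d {1} {2} (s≤s (s≤s z≤n)))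
      2*d<n : 2 * d < suc (suc k)
      2*d<n = subst (2 * d <_) (sym n≡d*e) (*-monoˡ-< d 2<d)

  ¬4∣n⇒4∣fall[n∸1,3] : ∀ n → ¬ 4 ∣ n → 4 ∣ fall (n ∸ 1) 3
  ¬4∣n⇒4∣fall[n∸1,3] zero 4∤0 = contradiction (4 ∣0) 4∤0
  ¬4∣n⇒4∣fall[n∸1,3] (suc m) 4∤n with suc m % 4 | m%n<n (suc m) 4 | m≡m%n+[m/n]*n (suc m) 4
  ... | zero  | _       | n≡q*4     = contradiction (divides (suc m / 4) n≡q*4) 4∤n
  ... | suc r | s≤s r<3 | n≡1+r+q*4 = ∣-trans (divides (suc m / 4) m∸r≡q*4) (m∸i∣fall m r<3)
    where
    m∸r≡q*4 : m ∸ r ≡ suc m / 4 * 4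
    m∸r≡q*4 = trans (cong (_∸ r) (suc-injective n≡1+r+q*4)) (m+n∸m≡n r (suc m / 4 * 4))

  ¬q∣fall : ∀ {q m} k → Prime q → q ∣ suc m → k < q → ¬ q ∣ fall m k
  ¬q∣fall zero pr _ _ q∣1 = ¬prime[1] (subst Prime (∣1⇒≡1 q∣1) pr)
  ¬q∣fall {q} {m} (suc k) pr q∣1+m 1+k<q q∣fall with euclidsLemma (fall m k) (m ∸ k) pr q∣fall
  ... | inj₁ q∣fall′ = ¬q∣fall k pr q∣1+m (<-trans (n<1+n k) 1+k<q) q∣fall′
  ... | inj₂ q∣m∸k  = <⇒≱ 1+k<q (∣⇒≤ (∣m+n∣m⇒∣n (subst (q ∣_) (sym m∸k+1+k≡1+m) q∣1+m) q∣m∸k))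
    where
    m∸k+1+k≡1+m : m ∸ k + suc k ≡ suc m
    m∸k+1+k≡1+m = trans (+-suc (m ∸ k) k)
                    (cong suc (m∸n+n≡m (<⇒≤ (≤-pred (≤-trans 1+k<q (∣⇒≤ q∣1+m))))))

  ¬4∣odd*fall : ∀ {r m} → 4 ∣ suc m → ¬ 2 ∣ r → ¬ 4 ∣ r * fall m 3
  ¬4∣odd*fall (divides zero ())
  ¬4∣odd*fall {r} (divides (suc w) refl) 2∤r 4∣r*fall =
    2∤odd (*-cancelˡ-∣ 2 (subst (4 ∣_) (r*fall≡2*odd r w) 4∣r*fall))
    where
    -- fall (3 + w * 4) 3 computes to (3 + w * 4) * (2 + w * 4) * (1 + w * 4).
    r*fall≡2*odd : ∀ r w → r * ((1 * (3 + w * 4)) * (2 + w * 4) * (1 + w * 4))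
                         ≡ 2 * (r * (1 + 2 * (1 + 2 * w)) * (1 + 2 * w) * (1 + 2 * (2 * w)))
    r*fall≡2*odd = solve-∀
    2∤odd : ¬ 2 ∣ r * (1 + 2 * (1 + 2 * w)) * (1 + 2 * w) * (1 + 2 * (2 * w))
    2∤odd = ¬2∣m*n (¬2∣m*n (¬2∣m*n 2∤r (¬2∣1+2*x (1 + 2 * w))) (¬2∣1+2*x w)) (¬2∣1+2*x (2 * w))

  -- If s > j then p ^ (s ∸ j) ≤ k, so it divides one of the factors k + j, …, j + 1 of the falling factorial.
  p^s∣1+k+j⇒p^s∣fall*p^j : ∀ {p} k j s → 1 < p → 0 < j → p ^ s ∣ suc (k + j) → p ^ s ∣ fall (k + j) k * p ^ j
  p^s∣1+k+j⇒p^s∣fall*p^j {p} k j s 1<p 0<j p^s∣N with s ≤? j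
  ... | yes s≤j = ∣n⇒∣m*n (fall (k + j) k) (divides (p ^ (j ∸ s))
                    (trans (cong (p ^_) (sym (m∸n+n≡m s≤j))) (^-distribˡ-+-* p (j ∸ s) s)))
  ... | no s≰j = subst (_∣ fall (k + j) k * p ^ j) (sym p^s≡p^d*p^j) (*-monoˡ-∣ (p ^ j) p^d∣fall)
    where
    instance _ = >-nonZero (<-trans z<s 1<p)
    d = s ∸ j
    0<d : 0 < d
    0<d = m<n⇒0<n∸m (≰⇒> s≰j)
    p^s≡p^d*p^j : p ^ s ≡ p ^ d * p ^ j
    p^s≡p^d*p^j = trans (cong (p ^_) (sym (m∸n+n≡m (<⇒≤ (≰⇒> s≰j))))) (^-distribˡ-+-* p d j)
    p^d≤k : p ^ d ≤ k
    p^d≤k = +-cancelʳ-≤ (suc j) (p ^ d) k (begin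
      p ^ d + suc j        ≤⟨ +-monoʳ-≤ (p ^ d) (n<p^n j 1<p) ⟩
      p ^ d + p ^ j        ≤⟨ m+n≤m*n (^-monoʳ-< p 1<p 0<d) (^-monoʳ-< p 1<p 0<j) ⟩
      p ^ d * p ^ j        ≡⟨ sym p^s≡p^d*p^j ⟩
      p ^ s                ≤⟨ ∣⇒≤ p^s∣N ⟩
      suc (k + j)          ≡⟨ sym (+-suc k j) ⟩
      k + suc j            ∎)
      where open ≤-Reasoning
    p^d∣fall : p ^ d ∣ fall (k + j) k
    p^d∣fall = ∣suc⇒∣fall (m^n>0 p d) p^d≤k
                 (∣-trans (subst (p ^ d ∣_) (sym p^s≡p^d*p^j) (m∣m*n (p ^ j))) p^s∣N)

  -- With N = p ^ s * r and p ∤ r, the hypothesis makes r * (z * y) a multiple of N * z.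
  p^e∣N*z⇒p^e∣z*y : ∀ {p e N z y} .{{_ : NonZero N}} → Prime p →
                    (∀ {s} → p ^ s ∣ N → p ^ s ∣ y) → p ^ e ∣ N * z → p ^ e ∣ z * y
  p^e∣N*z⇒p^e∣z*y {p} {e} {N} {z} pr absorbs p^e∣Nz with factor-out (prime⇒1<p pr) N
  ... | s , r , N≡p^s*r , p∤r with absorbs {s} (subst (p ^ s ∣_) (sym N≡p^s*r) (m∣m*n r))
  ...   | divides q refl = p^e∣m*n⇒p^e∣n e pr p∤r (subst (p ^ e ∣_) Nzq≡r*[z*q*p^s] (∣m⇒∣m*n q p^e∣Nz))
    where
    regroup : ∀ a r z q → a * r * z * q ≡ r * (z * (q * a))
    regroup = solve-∀
    Nzq≡r*[z*q*p^s] : N * z * q ≡ r * (z * (q * p ^ s))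
    Nzq≡r*[z*q*p^s] = trans (cong (λ N → N * z * q) N≡p^s*r) (regroup (p ^ s) r z q)

  p^e∣C*fall*p^j : ∀ {p e n} k j → Prime p → p ^ e ∣ n → 0 < j →
                   p ^ e ∣ (n C suc (k + j)) * (fall (k + j) k * p ^ j)
  p^e∣C*fall*p^j {e = e} {n} k j pr p^e∣n 0<j =
    p^e∣N*z⇒p^e∣z*y {e = e} pr (λ {s} → p^s∣1+k+j⇒p^s∣fall*p^j k j s (prime⇒1<p pr) 0<j)
      (∣-trans p^e∣n (n∣[1+j]*nC[1+j] n (k + j)))

module Expansion where
  open import Data.Nat as ℕ using (ℕ; zero; suc; z≤n; s≤s)
  import Data.Nat.Properties as ℕₚ
  open import Data.Nat.Combinatorics using (_C_; k>n⇒nCk≡0; nCk+nC[k+1]≡[n+1]C[k+1])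
  open import Data.Fin.Base using (toℕ)
  open import Data.Integer.Base using (ℤ; +_; _+_; _*_; _-_; _^_; 0ℤ; 1ℤ; +-0-rawMonoid; +-*-rawSemiring)
  open import Data.Integer.Properties
  open import Data.Integer.Tactic.RingSolver using (solve-∀)
  open import Algebra.Properties.CommutativeSemigroup +-commutativeSemigroup using (interchange)
  open import Algebra.Properties.Semiring.Sum +-*-semiring using (sum)
  import Algebra.Definitions.RawMonoid +-0-rawMonoid as Additive
  import Algebra.Definitions.RawSemiring +-*-rawSemiring as Semiring
  import Algebra.Properties.CommutativeSemiring.Binomial +-*-commutativeSemiring as Binomial
  open FallingFactorial using (m<k⇒fall≡0; fall-pascal; C-fall)
  open ≡-Reasoning

  sumTo-cong : ∀ n {f g : ℕ → ℤ} → (∀ i → f i ≡ g i) → sumTo n f ≡ sumTo n g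
  sumTo-cong zero    f≗g = refl
  sumTo-cong (suc n) f≗g = cong₂ _+_ (sumTo-cong n f≗g) (f≗g n)

  sumTo-+ : ∀ n (f g : ℕ → ℤ) → sumTo n (λ i → f i + g i) ≡ sumTo n f + sumTo n g
  sumTo-+ zero    f g = refl
  sumTo-+ (suc n) f g = trans (cong (_+ (f n + g n)) (sumTo-+ n f g)) (interchange (sumTo n f) (sumTo n g) (f n) (g n))

  sumTo-*ˡ : ∀ n c (f : ℕ → ℤ) → sumTo n (λ i → c * f i) ≡ c * sumTo n f
  sumTo-*ˡ zero    c f = sym (*-zeroʳ c)
  sumTo-*ˡ (suc n) c f = trans (cong (_+ c * f n) (sumTo-*ˡ n c f)) (sym (*-distribˡ-+ c (sumTo n f) (f n)))

  sumTo-shift : ∀ n (f : ℕ → ℤ) → sumTo (suc n) f ≡ f 0 + sumTo n (f ∘ suc)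
  sumTo-shift zero    f = +-comm 0ℤ (f 0)
  sumTo-shift (suc n) f = trans (cong (_+ f (suc n)) (sumTo-shift n f)) (+-assoc (f 0) _ (f (suc n)))

  sumTo-vanishing : ∀ {m} n (f : ℕ → ℤ) → (∀ i → m ℕ.≤ i → f i ≡ 0ℤ) → m ℕ.≤ n → sumTo n f ≡ sumTo m f
  sumTo-vanishing zero    f _ z≤n = refl
  sumTo-vanishing (suc n) f f≡0 m≤1+n with ℕₚ.m≤n⇒m<n∨m≡n m≤1+n
  ... | inj₂ refl      = refl
  ... | inj₁ (s≤s m≤n) = trans (cong₂ _+_ (sumTo-vanishing n f f≡0 m≤n) (f≡0 n m≤n)) (+-identityʳ _)

  sumTo≡sum : ∀ n (f : ℕ → ℤ) → sumTo n f ≡ sum {n} (f ∘ toℕ)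
  sumTo≡sum zero    f = refl
  sumTo≡sum (suc n) f = trans (sumTo-shift n f) (cong (λ s → f 0 + s) (sumTo≡sum n (f ∘ suc)))

  -- The library states it with the semiring's iterated _×_ and _^_ and with Fin-indexed sums.
  binomial-theorem : ∀ (β : ℤ) m → (β + 1ℤ) ^ m ≡ sumTo (suc m) (λ j → + (m C j) * β ^ j)
  binomial-theorem β m = begin
    (β + 1ℤ) ^ m                         ≡⟨ sym (^≡^ (β + 1ℤ) m) ⟩
    (β + 1ℤ) Semiring.^ m                ≡⟨ Binomial.theorem m β 1ℤ ⟩
    Binomial.binomialExpansion β 1ℤ m    ≡⟨ sym (sumTo≡sum (suc m) term) ⟩
    sumTo (suc m) term                   ≡⟨ sumTo-cong (suc m) term≡ ⟩
    sumTo (suc m) (λ j → + (m C j) * β ^ j) ∎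
    where
    ×≡* : ∀ n x → n Additive.× x ≡ + n * x
    ×≡* zero    x = refl
    ×≡* (suc n) x = trans (cong (λ y → x + y) (×≡* n x))
                      (sym (trans (*-distribʳ-+ x (+ 1) (+ n)) (cong (_+ + n * x) (*-identityˡ x))))
    ^≡^ : ∀ x n → x Semiring.^ n ≡ x ^ n
    ^≡^ x zero    = refl
    ^≡^ x (suc n) = cong (x *_) (^≡^ x n)
    term : ℕ → ℤ
    term j = (m C j) Additive.× (β Semiring.^ j * 1ℤ Semiring.^ (m ℕ.∸ j))
    term≡ : ∀ j → term j ≡ + (m C j) * β ^ j
    term≡ j = trans (×≡* (m C j) _) (cong (+ (m C j) *_)
                (trans (cong₂ _*_ (^≡^ β j) (trans (^≡^ 1ℤ (m ℕ.∸ j)) (^-zeroˡ (m ℕ.∸ j)))) (*-identityʳ (β ^ j))))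

  pow-derivative-expansion : ∀ n k α →
    sumTo (suc n) (λ j → + ((n C (k ℕ.+ j)) ℕ.* fall (k ℕ.+ j) k) * (α - 1ℤ) ^ j) ≡ + fall n k * α ^ (n ℕ.∸ k)
  pow-derivative-expansion n k α = begin
    sumTo (suc n) (λ j → + ((n C (k ℕ.+ j)) ℕ.* fall (k ℕ.+ j) k) * β ^ j)
      ≡⟨ sumTo-cong (suc n) term≡ ⟩
    sumTo (suc n) (λ j → + fall n k * b j)        ≡⟨ sumTo-*ˡ (suc n) (+ fall n k) b ⟩
    + fall n k * sumTo (suc n) b                  ≡⟨ cong (+ fall n k *_) (sumTo-vanishing (suc n) b b≡0 (s≤s (ℕₚ.m∸n≤m n k))) ⟩
    + fall n k * sumTo (suc (n ℕ.∸ k)) b          ≡⟨ cong (+ fall n k *_) (sym (binomial-theorem β (n ℕ.∸ k))) ⟩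
    + fall n k * (β + 1ℤ) ^ (n ℕ.∸ k)             ≡⟨ cong (λ x → + fall n k * x ^ (n ℕ.∸ k)) (β+1≡α α) ⟩
    + fall n k * α ^ (n ℕ.∸ k)                    ∎
    where
    β = α - 1ℤ
    β+1≡α : ∀ α → α - 1ℤ + 1ℤ ≡ α
    β+1≡α = solve-∀
    b : ℕ → ℤ
    b j = + ((n ℕ.∸ k) C j) * β ^ j
    term≡ : ∀ j → + ((n C (k ℕ.+ j)) ℕ.* fall (k ℕ.+ j) k) * β ^ j ≡ + fall n k * b j
    term≡ j = trans (cong (λ c → + c * β ^ j) (C-fall n k j))
                (trans (cong (_* β ^ j) (pos-* (fall n k) ((n ℕ.∸ k) C j))) (*-assoc (+ fall n k) _ (β ^ j)))
    b≡0 : ∀ j → suc (n ℕ.∸ k) ℕ.≤ j → b j ≡ 0ℤ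
    b≡0 j n∸k<j = cong (λ c → + c * β ^ j) (k>n⇒nCk≡0 n∸k<j)

  taylorTerm : ℕ → ℕ → ℤ → ℕ → ℤ
  taylorTerm n k α j = + ((n C suc (k ℕ.+ j)) ℕ.* fall (k ℕ.+ j) k) * (α - 1ℤ) ^ j

  S-taylor : ∀ n k α → S n k α ≡ sumTo n (taylorTerm n k α)
  S-taylor zero    k α = refl
  S-taylor (suc n) k α = sym (begin
    sumTo (suc n) (taylorTerm (suc n) k α)                ≡⟨ sumTo-cong (suc n) pascal ⟩
    sumTo (suc n) (λ j → a j + taylorTerm n k α j)        ≡⟨ sumTo-+ (suc n) a (taylorTerm n k α) ⟩
    sumTo (suc n) a + sumTo (suc n) (taylorTerm n k α)
      ≡⟨ cong₂ _+_ (pow-derivative-expansion n k α) (sumTo-vanishing (suc n) (taylorTerm n k α) last≡0 (ℕₚ.n≤1+n n)) ⟩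
    + fall n k * α ^ (n ℕ.∸ k) + sumTo n (taylorTerm n k α) ≡⟨ +-comm (+ fall n k * α ^ (n ℕ.∸ k)) _ ⟩
    sumTo n (taylorTerm n k α) + + fall n k * α ^ (n ℕ.∸ k) ≡⟨ cong (_+ + fall n k * α ^ (n ℕ.∸ k)) (sym (S-taylor n k α)) ⟩
    S (suc n) k α                                          ∎)
    where
    a : ℕ → ℤ
    a j = + ((n C (k ℕ.+ j)) ℕ.* fall (k ℕ.+ j) k) * (α - 1ℤ) ^ j
    pascal : ∀ j → taylorTerm (suc n) k α j ≡ a j + taylorTerm n k α j
    pascal j = begin
      + ((suc n C suc (k ℕ.+ j)) ℕ.* F) * β^j
        ≡⟨ cong (λ c → + (c ℕ.* F) * β^j) (sym (nCk+nC[k+1]≡[n+1]C[k+1] n (k ℕ.+ j))) ⟩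
      + (((n C (k ℕ.+ j)) ℕ.+ (n C suc (k ℕ.+ j))) ℕ.* F) * β^j
        ≡⟨ cong (λ c → + c * β^j) (ℕₚ.*-distribʳ-+ F (n C (k ℕ.+ j)) _) ⟩
      + ((n C (k ℕ.+ j)) ℕ.* F ℕ.+ (n C suc (k ℕ.+ j)) ℕ.* F) * β^j
        ≡⟨ cong (_* β^j) (pos-+ ((n C (k ℕ.+ j)) ℕ.* F) ((n C suc (k ℕ.+ j)) ℕ.* F)) ⟩
      (+ ((n C (k ℕ.+ j)) ℕ.* F) + + ((n C suc (k ℕ.+ j)) ℕ.* F)) * β^j
        ≡⟨ *-distribʳ-+ β^j (+ ((n C (k ℕ.+ j)) ℕ.* F)) (+ ((n C suc (k ℕ.+ j)) ℕ.* F)) ⟩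
      a j + taylorTerm n k α j ∎
      where
      F = fall (k ℕ.+ j) k
      β^j = (α - 1ℤ) ^ j
    last≡0 : ∀ j → n ℕ.≤ j → taylorTerm n k α j ≡ 0ℤ
    last≡0 j n≤j = cong (λ c → + (c ℕ.* fall (k ℕ.+ j) k) * (α - 1ℤ) ^ j)
                     (k>n⇒nCk≡0 (s≤s (ℕₚ.≤-trans n≤j (ℕₚ.m≤n+m j k))))

  S-recurrence₀ : ∀ n α → (α - 1ℤ) * S n 0 α ≡ α ^ n - 1ℤ
  S-recurrence₀ zero    α = *-zeroʳ (α - 1ℤ)
  S-recurrence₀ (suc n) α = begin
    (α - 1ℤ) * (S n 0 α + 1ℤ * α ^ n)          ≡⟨ distrib α (S n 0 α) (α ^ n) ⟩
    (α - 1ℤ) * S n 0 α + (α * α ^ n - α ^ n)   ≡⟨ cong (_+ (α * α ^ n - α ^ n)) (S-recurrence₀ n α) ⟩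
    α ^ n - 1ℤ + (α * α ^ n - α ^ n)           ≡⟨ telescope (α * α ^ n) (α ^ n) ⟩
    α * α ^ n - 1ℤ                             ∎
    where
    distrib : ∀ α s x → (α - 1ℤ) * (s + 1ℤ * x) ≡ (α - 1ℤ) * s + (α * x - x)
    distrib = solve-∀
    telescope : ∀ y x → x - 1ℤ + (y - x) ≡ y - 1ℤ
    telescope = solve-∀

  -- When n ≤ k both exponents truncate to 0; the identity then holds because the falling factorial vanishes.
  α*fall*α^[n∸1+k] : ∀ n k α → α * (+ fall n (suc k) * α ^ (n ℕ.∸ suc k)) ≡ + fall n (suc k) * α ^ (n ℕ.∸ k)
  α*fall*α^[n∸1+k] n k α with k ℕ.<? n
  ... | yes k<n = trans (swap α (+ fall n (suc k)) _) (cong (λ e → + fall n (suc k) * α ^ e) (sym (ℕₚ.+-∸-assoc 1 k<n)))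
    where
    swap : ∀ x y z → x * (y * z) ≡ y * (x * z)
    swap = solve-∀
  ... | no k≮n rewrite m<k⇒fall≡0 (s≤s (ℕₚ.≮⇒≥ k≮n)) = *-zeroʳ α

  S-recurrence : ∀ n k α → (α - 1ℤ) * S n (suc k) α + + suc k * S n k α ≡ + fall n (suc k) * α ^ (n ℕ.∸ suc k)
  S-recurrence zero    k α = trans (cong₂ _+_ (*-zeroʳ (α - 1ℤ)) (*-zeroʳ (+ suc k)))
                                   (cong (λ c → + c * 1ℤ) (sym (m<k⇒fall≡0 {0} {suc k} (s≤s z≤n))))
  S-recurrence (suc n) k α = begin
    (α - 1ℤ) * (s′ + u) + c * (s + v)           ≡⟨ regroup α s′ s u v c ⟩
    ((α - 1ℤ) * s′ + c * s) + (α - 1ℤ) * u + c * v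
                                                ≡⟨ cong (λ x → x + (α - 1ℤ) * u + c * v) (S-recurrence n k α) ⟩
    u + (α - 1ℤ) * u + c * v                    ≡⟨ collect α u (c * v) ⟩
    α * u + c * v                               ≡⟨ cong (_+ c * v) (α*fall*α^[n∸1+k] n k α) ⟩
    + fall n (suc k) * α^[n∸k] + c * (+ fall n k * α^[n∸k])
                                                ≡⟨ factor (+ fall n (suc k)) c (+ fall n k) α^[n∸k] ⟩
    (+ fall n (suc k) + c * + fall n k) * α^[n∸k]
                                                ≡⟨ cong (_* α^[n∸k]) coeff ⟩
    + fall (suc n) (suc k) * α^[n∸k]            ∎
    where
    s′ = S n (suc k) α
    s  = S n k α
    c  = + suc k
    u  = + fall n (suc k) * α ^ (n ℕ.∸ suc k)
    α^[n∸k] = α ^ (n ℕ.∸ k)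
    v  = + fall n k * α^[n∸k]
    regroup : ∀ α s′ s u v c → (α - 1ℤ) * (s′ + u) + c * (s + v) ≡ ((α - 1ℤ) * s′ + c * s) + (α - 1ℤ) * u + c * v
    regroup = solve-∀
    collect : ∀ α u w → u + (α - 1ℤ) * u + w ≡ α * u + w
    collect = solve-∀
    factor : ∀ a c b x → a * x + c * (b * x) ≡ (a + c * b) * x
    factor = solve-∀
    coeff : + fall n (suc k) + c * + fall n k ≡ + fall (suc n) (suc k)
    coeff = begin
      + fall n (suc k) + + suc k * + fall n k   ≡⟨ cong (λ x → + fall n (suc k) + x) (sym (pos-* (suc k) (fall n k))) ⟩
      + fall n (suc k) + + (suc k ℕ.* fall n k) ≡⟨ sym (pos-+ (fall n (suc k)) _) ⟩
      + (fall n (suc k) ℕ.+ suc k ℕ.* fall n k) ≡⟨ cong +_ (sym (fall-pascal n k)) ⟩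
      + fall (suc n) (suc k)                    ∎

module Criterion where
  open import Data.Nat as ℕ using (ℕ; zero; suc; _<_; _^_; z≤n; s≤s; z<s; >-nonZero)
  import Data.Nat.Properties as ℕₚ
  open import Data.Nat.Divisibility using (_∣_; divides; _∣?_; _∣0; ∣-trans; m∣m*n; ∣m⇒∣m*n; *-monoʳ-∣; 1∣_; ∣1⇒≡1)
  open import Data.Nat.Combinatorics using (_C_)
  open import Data.Nat.Primality using (Prime; prime?; euclidsLemma; prime⇒irreducible; prime⇒nonZero; prime[2]; ¬prime[1])
  open import Data.Integer.Base using (ℤ; +_; _+_; _*_; _-_; ∣_∣; 1ℤ; _%ℕ_; _/ℕ_) renaming (_^_ to _^ℤ_)
  open import Data.Integer.Properties using (abs-*; *-identityʳ; +-identityˡ)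
  open import Data.Integer.DivMod using (n%ℕd<d; a≡a%ℕn+[a/ℕn]*n)
  import Data.Integer.Divisibility.Signed as ℤ∣
  open ℤ∣ using (∣ᵤ⇒∣; ∣⇒∣ᵤ) renaming (_∣_ to _∣ℤ_)
  open import Data.Integer.Tactic.RingSolver using (solve-∀)
  open import Function.Bundles using (_⇔_; mk⇔; Equivalence)
  open NatArithmetic
  open FallingFactorial
  open Expansion

  Condition : ℕ → ℕ → ℤ → Set
  Condition k n α = ((suc k ≢ 4) × ¬ Prime (suc k))
                  ⊎ ((suc k ≡ 4) × ¬ (4 ∣ n))
                  ⊎ (Prime (suc k) × (¬ (suc k ∣ n) ⊎ ¬ (suc k ∣ ∣ α - 1ℤ ∣)))

  abs-^ : ∀ x j → ∣ x ^ℤ j ∣ ≡ ∣ x ∣ ^ j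
  abs-^ x zero    = refl
  abs-^ x (suc j) = trans (abs-* x (x ^ℤ j)) (cong (∣ x ∣ ℕ.*_) (abs-^ x j))

  ∣ℤ-sumTo : ∀ {d} n {f : ℕ → ℤ} → (∀ i → d ∣ℤ f i) → d ∣ℤ sumTo n f
  ∣ℤ-sumTo {d} zero    _    = ∣ᵤ⇒∣ (∣ d ∣ ∣0)
  ∣ℤ-sumTo     (suc n) d∣fi = ℤ∣.∣m∣n⇒∣m+n (∣ℤ-sumTo n d∣fi) (d∣fi n)

  p^e∣a*x⇒p^e∣x : ∀ {p} e {a x} → Prime p → ¬ p ∣ ∣ a ∣ → + (p ^ e) ∣ℤ a * x → + (p ^ e) ∣ℤ x
  p^e∣a*x⇒p^e∣x e {a} {x} pr p∤a p^e∣ax =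
    ∣ᵤ⇒∣ (p^e∣m*n⇒p^e∣n e pr p∤a (subst (_ ∣_) (abs-* a x) (∣⇒∣ᵤ p^e∣ax)))

  p∤α-1⇒p^e∣S : ∀ {p e n α} → Prime p → ¬ p ∣ ∣ α - 1ℤ ∣ → p ^ e ∣ n →
                + (p ^ e) ∣ℤ α ^ℤ n - 1ℤ → ∀ k → + (p ^ e) ∣ℤ S n k α
  p∤α-1⇒p^e∣S {p} {e} {n} {α} pr p∤β p^e∣n p^e∣α^n-1 zero =
    p^e∣a*x⇒p^e∣x e {α - 1ℤ} pr p∤β (subst (+ (p ^ e) ∣ℤ_) (sym (S-recurrence₀ n α)) p^e∣α^n-1)
  p∤α-1⇒p^e∣S {p} {e} {n} {α} pr p∤β p^e∣n p^e∣α^n-1 (suc k) =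
    p^e∣a*x⇒p^e∣x e {α - 1ℤ} pr p∤β
      (ℤ∣.∣m+n∣n⇒∣m (subst (+ (p ^ e) ∣ℤ_) (sym (S-recurrence n k α)) p^e∣rhs)
                    (ℤ∣.∣n⇒∣m*n (+ suc k) (p∤α-1⇒p^e∣S {e = e} pr p∤β p^e∣n p^e∣α^n-1 k)))
    where
    p^e∣rhs : + (p ^ e) ∣ℤ + fall n (suc k) * α ^ℤ (n ℕ.∸ suc k)
    p^e∣rhs = ℤ∣.∣m⇒∣m*n {m = + fall n (suc k)} (α ^ℤ (n ℕ.∸ suc k))
                (∣ᵤ⇒∣ (∣-trans p^e∣n (subst (n ∣_) (sym (fall-suc n k)) (m∣m*n (fall (n ℕ.∸ 1) k)))))

  p∣α-1⇒p^e∣taylorTerm : ∀ {p e n} k α → Prime p → p ∣ ∣ α - 1ℤ ∣ → p ^ e ∣ n →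
                          ∀ j → + (p ^ e) ∣ℤ taylorTerm n k α (suc j)
  p∣α-1⇒p^e∣taylorTerm {p} {e} {n} k α pr p∣β p^e∣n j = ∣ᵤ⇒∣ (subst (p ^ e ∣_) (sym ∣term∣≡) (∣-trans
    (subst (p ^ e ∣_) (sym (ℕₚ.*-assoc c f (p ^ suc j))) (p^e∣C*fall*p^j {e = e} k (suc j) pr p^e∣n z<s))
    (*-monoʳ-∣ (c ℕ.* f) (^-monoˡ-∣ (suc j) p∣β))))
    where
    c = n C suc (k ℕ.+ suc j)
    f = fall (k ℕ.+ suc j) k
    ∣term∣≡ : ∣ taylorTerm n k α (suc j) ∣ ≡ c ℕ.* f ℕ.* ∣ α - 1ℤ ∣ ^ suc j
    ∣term∣≡ = trans (abs-* (+ (c ℕ.* f)) ((α - 1ℤ) ^ℤ suc j)) (cong (c ℕ.* f ℕ.*_) (abs-^ (α - 1ℤ) (suc j)))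

  taylorTerm₀≡leadingCoeff : ∀ n k α → taylorTerm n k α 0 ≡ + leadingCoeff n k
  taylorTerm₀≡leadingCoeff n k α = begin
    + ((n C suc (k ℕ.+ 0)) ℕ.* fall (k ℕ.+ 0) k) * 1ℤ  ≡⟨ *-identityʳ _ ⟩
    + ((n C suc (k ℕ.+ 0)) ℕ.* fall (k ℕ.+ 0) k)       ≡⟨ cong (λ i → + ((n C suc i) ℕ.* fall i k)) (ℕₚ.+-identityʳ k) ⟩
    + ((n C suc k) ℕ.* fall k k)                        ≡⟨ cong (λ x → + ((n C suc k) ℕ.* x)) (fall[n,n]≡n! k) ⟩
    + leadingCoeff n k                                  ∎
    where open ≡-Reasoning

  p∣α-1⇒[p^e∣S⇔p^e∣leadingCoeff] : ∀ {p e n} k α → Prime p → p ∣ ∣ α - 1ℤ ∣ → p ^ e ∣ n →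
                                    + (p ^ e) ∣ℤ S n k α ⇔ p ^ e ∣ leadingCoeff n k
  p∣α-1⇒[p^e∣S⇔p^e∣leadingCoeff] {p} {e} {zero} k α _ _ _ = mk⇔ (λ _ → (p ^ e) ∣0) (λ _ → ∣ᵤ⇒∣ ((p ^ e) ∣0))
  p∣α-1⇒[p^e∣S⇔p^e∣leadingCoeff] {p} {e} {suc n} k α pr p∣β p^e∣n = mk⇔
    (λ p^e∣S → ∣⇒∣ᵤ (subst (+ (p ^ e) ∣ℤ_) leading≡
                       (ℤ∣.∣m+n∣n⇒∣m (subst (+ (p ^ e) ∣ℤ_) S≡ p^e∣S) p^e∣tail)))
    (λ p^e∣lead → subst (+ (p ^ e) ∣ℤ_) (sym S≡)
                    (ℤ∣.∣m∣n⇒∣m+n (subst (+ (p ^ e) ∣ℤ_) (sym leading≡) (∣ᵤ⇒∣ p^e∣lead)) p^e∣tail))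
    where
    tail = sumTo n (taylorTerm (suc n) k α ∘ suc)
    S≡ : S (suc n) k α ≡ taylorTerm (suc n) k α 0 + tail
    S≡ = trans (S-taylor (suc n) k α) (sumTo-shift n (taylorTerm (suc n) k α))
    leading≡ : taylorTerm (suc n) k α 0 ≡ + leadingCoeff (suc n) k
    leading≡ = taylorTerm₀≡leadingCoeff (suc n) k α
    p^e∣tail : + (p ^ e) ∣ℤ tail
    p^e∣tail = ∣ℤ-sumTo n (p∣α-1⇒p^e∣taylorTerm {e = e} k α pr p∣β p^e∣n)

  condition⇒p^e∣leadingCoeff : ∀ {p e n k α} → Condition k n α → Prime p → p ∣ ∣ α - 1ℤ ∣ → p ^ e ∣ n →
                                p ^ e ∣ leadingCoeff n k
  condition⇒p^e∣leadingCoeff {n = n} {k} (inj₁ (≢4 , ¬prime)) _ _ p^e∣n =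
    ∣-trans p^e∣n (n∣leadingCoeff (∣-trans ([1+k]∣k! ¬prime ≢4) (k!∣fall (n ℕ.∸ 1) k)))
  condition⇒p^e∣leadingCoeff {n = n} (inj₂ (inj₁ (refl , 4∤n))) _ _ p^e∣n =
    ∣-trans p^e∣n (n∣leadingCoeff (¬4∣n⇒4∣fall[n∸1,3] n 4∤n))
  condition⇒p^e∣leadingCoeff {p} {e} {n} {k} (inj₂ (inj₂ (q-prime , q∤n⊎q∤β))) pr p∣β p^e∣n with p ℕ.≟ suc k
  ... | no p≢q =
    p^e∣m*n⇒p^e∣n e pr p∤q (subst (p ^ e ∣_) (sym ([1+k]*leadingCoeff≡n*fall n k)) (∣m⇒∣m*n _ p^e∣n))
    where
    p∤q : ¬ p ∣ suc k
    p∤q p∣q = [ (λ p≡1 → ¬prime[1] (subst Prime p≡1 pr)) , p≢q ]′ (prime⇒irreducible q-prime p∣q)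
  ... | yes refl with e | q∤n⊎q∤β
  ...   | zero  | _          = 1∣ _
  ...   | suc e | inj₁ q∤n   = contradiction (∣-trans (m∣m*n (p ^ e)) p^e∣n) q∤n
  ...   | suc e | inj₂ q∤β   = contradiction p∣β q∤β

  parity : ∀ α → + 2 ∣ℤ α ⊎ + 2 ∣ℤ α - 1ℤ
  parity α with α %ℕ 2 | n%ℕd<d α 2 | a≡a%ℕn+[a/ℕn]*n α 2
  ... | 0 | _ | α≡0+q*2 = inj₁ (ℤ∣.divides (α /ℕ 2) (trans α≡0+q*2 (+-identityˡ _)))
  ... | 1 | _ | α≡1+q*2 = inj₂ (ℤ∣.divides (α /ℕ 2) (trans (cong (_- 1ℤ) α≡1+q*2) (1+x-1≡x _)))
    where
    1+x-1≡x : ∀ x → 1ℤ + x - 1ℤ ≡ x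
    1+x-1≡x = solve-∀
  ... | suc (suc _) | s≤s (s≤s ()) | _

  2∣α^n-1⇒2∣α-1 : ∀ {n α} → 0 < n → + 2 ∣ℤ α ^ℤ n - 1ℤ → + 2 ∣ℤ α - 1ℤ
  2∣α^n-1⇒2∣α-1 {suc n} {α} _ 2∣α^n-1 with parity α
  ... | inj₂ 2∣α-1 = 2∣α-1
  ... | inj₁ 2∣α   = contradiction (∣1⇒≡1 (∣⇒∣ᵤ 2∣1)) λ ()
    where
    x-[x-1]≡1 : ∀ x → x - (x - 1ℤ) ≡ 1ℤ
    x-[x-1]≡1 = solve-∀
    2∣1 : + 2 ∣ℤ 1ℤ
    2∣1 = subst (+ 2 ∣ℤ_) (x-[x-1]≡1 (α ^ℤ suc n)) (ℤ∣.∣m∣n⇒∣m-n (ℤ∣.∣m⇒∣m*n (α ^ℤ n) 2∣α) 2∣α^n-1)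

  n∣S⇒[1+k]∣m*fall : ∀ {p e m n k α} → Prime p → p ∣ ∣ α - 1ℤ ∣ → suc n ≡ p ^ e ℕ.* m →
                      + suc n ∣ℤ S (suc n) k α → suc k ∣ m ℕ.* fall n k
  n∣S⇒[1+k]∣m*fall {p} {e} {m} {n} {k} {α} pr p∣β n≡p^e*m n∣S =
    c*t≡a*x∧a∣t⇒c∣x {{ℕₚ.m^n≢0 p e {{prime⇒nonZero pr}}}} [1+k]*lead≡p^e*[m*fall] p^e∣lead
    where
    p^e∣n : p ^ e ∣ suc n
    p^e∣n = subst (p ^ e ∣_) (sym n≡p^e*m) (m∣m*n m)
    p^e∣lead : p ^ e ∣ leadingCoeff (suc n) k
    p^e∣lead = Equivalence.to (p∣α-1⇒[p^e∣S⇔p^e∣leadingCoeff] {e = e} k α pr p∣β p^e∣n)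
                 (ℤ∣.∣-trans (∣ᵤ⇒∣ p^e∣n) n∣S)
    [1+k]*lead≡p^e*[m*fall] : suc k ℕ.* leadingCoeff (suc n) k ≡ p ^ e ℕ.* (m ℕ.* fall n k)
    [1+k]*lead≡p^e*[m*fall] = trans ([1+k]*leadingCoeff≡n*fall (suc n) k)
                                (trans (cong (ℕ._* fall n k) n≡p^e*m) (ℕₚ.*-assoc (p ^ e) m (fall n k)))

  q∣n∧q∣α-1⇒n∤S : ∀ {n k α} → 0 < n → Prime (suc k) → suc k ∣ n → suc k ∣ ∣ α - 1ℤ ∣ → ¬ + n ∣ℤ S n k α
  q∣n∧q∣α-1⇒n∤S {suc n} {k} _ pr q∣n q∣β n∣S with factor-out (prime⇒1<p pr) (suc n)
  ... | e , m , n≡q^e*m , q∤m =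
    [ q∤m , ¬q∣fall k pr q∣n (ℕₚ.n<1+n k) ]′
      (euclidsLemma m (fall n k) pr (n∣S⇒[1+k]∣m*fall {e = e} {m} pr q∣β n≡q^e*m n∣S))

  4∣n⇒n∤S : ∀ {n α} → 0 < n → 4 ∣ n → + n ∣ℤ α ^ℤ n - 1ℤ → ¬ + n ∣ℤ S n 3 α
  4∣n⇒n∤S {suc n} {α} 0<n 4∣n n∣α^n-1 n∣S with factor-out {2} (s≤s (s≤s z≤n)) (suc n)
  ... | e , m , n≡2^e*m , 2∤m =
    ¬4∣odd*fall 4∣n 2∤m (n∣S⇒[1+k]∣m*fall {e = e} {m} prime[2] 2∣β n≡2^e*m n∣S)
    where
    2∣β : 2 ∣ ∣ α - 1ℤ ∣
    2∣β = ∣⇒∣ᵤ (2∣α^n-1⇒2∣α-1 {α = α} 0<n (ℤ∣.∣-trans (∣ᵤ⇒∣ (∣-trans (divides 2 refl) 4∣n)) n∣α^n-1))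

  condition⇒n∣S : ∀ {n k α} → 0 < n → + n ∣ℤ α ^ℤ n - 1ℤ → Condition k n α → n ∣ ∣ S n k α ∣
  condition⇒n∣S {n} {k} {α} 0<n n∣α^n-1 cond =
    ∣-by-prime-powers n {{>-nonZero 0<n}} ∣ S n k α ∣ (λ {p} {e} → p^e∣S {p} {e})
    where
    p^e∣S : ∀ {p e} → Prime p → p ^ e ∣ n → p ^ e ∣ ∣ S n k α ∣
    p^e∣S {p} {e} pr p^e∣n with p ∣? ∣ α - 1ℤ ∣
    ... | no p∤β  = ∣⇒∣ᵤ (p∤α-1⇒p^e∣S {e = e} {α = α} pr p∤β p^e∣n (ℤ∣.∣-trans (∣ᵤ⇒∣ p^e∣n) n∣α^n-1) k)
    ... | yes p∣β = ∣⇒∣ᵤ (Equivalence.from (p∣α-1⇒[p^e∣S⇔p^e∣leadingCoeff] {e = e} k α pr p∣β p^e∣n)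
                                          (condition⇒p^e∣leadingCoeff {e = e} {α = α} cond pr p∣β p^e∣n))

  n∣S⇒condition : ∀ {n k α} → 0 < n → + n ∣ℤ α ^ℤ n - 1ℤ → + n ∣ℤ S n k α → Condition k n α
  n∣S⇒condition {n} {k} {α} 0<n n∣α^n-1 n∣S with prime? (suc k)
  ... | yes q-prime with suc k ∣? n | suc k ∣? ∣ α - 1ℤ ∣
  ...   | no q∤n  | _       = inj₂ (inj₂ (q-prime , inj₁ q∤n))
  ...   | yes _   | no q∤β  = inj₂ (inj₂ (q-prime , inj₂ q∤β))
  ...   | yes q∣n | yes q∣β = contradiction n∣S (q∣n∧q∣α-1⇒n∤S 0<n q-prime q∣n q∣β)
  n∣S⇒condition {n} {k} {α} 0<n n∣α^n-1 n∣S | no ¬prime with suc k ℕ.≟ 4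
  ... | no ≢4 = inj₁ (≢4 , ¬prime)
  ... | yes refl with 4 ∣? n
  ...   | no 4∤n  = inj₂ (inj₁ (refl , 4∤n))
  ...   | yes 4∣n = contradiction n∣S (4∣n⇒n∤S 0<n 4∣n n∣α^n-1)

open import Data.Nat using (ℕ; suc; _≥_)
import Data.Nat.Divisibility as ℕD
open import Data.Nat.Primality using (Prime)
open import Data.Integer using (ℤ; +_; _-_; _^_)
open import Data.Integer.Divisibility using (_∣_)
open import Data.Integer.Divisibility.Signed using (∣ᵤ⇒∣)
open import Function.Bundles using (_⇔_; mk⇔)
open Criterion using (n∣S⇒condition; condition⇒n∣S)

theorem1 : (k n : ℕ) → n ≥ 1 → (α : ℤ) → (+ n) ∣ (α ^ n - + 1) →
    ((+ n) ∣ S n k α) ⇔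
      ( ((suc k ≢ 4) × ¬ Prime (suc k))
      ⊎ ((suc k ≡ 4) × ¬ (4 ℕD.∣ n))
      ⊎ (Prime (suc k) × (¬ (suc k ℕD.∣ n) ⊎ ¬ ((+ suc k) ∣ (α - + 1)))) )
theorem1 k n n≥1 α n∣α^n-1 = mk⇔
  (λ n∣S → n∣S⇒condition n≥1 (∣ᵤ⇒∣ n∣α^n-1) (∣ᵤ⇒∣ n∣S))
  (condition⇒n∣S n≥1 (∣ᵤ⇒∣ n∣α^n-1))
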